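{- Let $k,l,n$ be positive integers. Let $A=\{a_1,a_2,\dots,a_{s_a}\}\subset[n]$ with $a_1<\cdots<a_{s_a}$, and let $B=\{b_1,b_2,\dots,b_{s_b}\}$ with $b_1<\cdots<b_{s_b}$ be $A$'s partner. Then $$|\mathcal{L}([n],A,k)|=\binom{n-b_1}{k-b_1}+\binom{n-b_2}{k-b_2+1}+\cdots+\binom{n-b_{s_b}}{k-b_{s_b}+s_b-1},$$ $$|\mathcal{L}([n],B,l)|=\binom{n-a_1}{l-a_1}+\binom{n-a_2}{l-a_2+1}+\cdots+\binom{n-a_{s_a}}{l-a_{s_a}+s_a-1}.$$
   Context: Lexicographic order: $A\prec B$ if either $A\supseteq B$ or $\min(A\setminus B)<\min(B\setminus A)$. $\mathcal{L}([n],R,k)=\{F\in\binom{[n]}{k}:F\prec R\}$. Sets $A,B$ strongly intersect at their last element $q$ if $A\cap B=\{q\}$ and $A\cup B=[q]$; then $B$ is called $A$'s partner. Binomial coefficients $\binom{x}{y}$ are $0$ when $y<0$ or $y>x$. -}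

module Defs where

open import Data.Nat using (ℕ; zero; suc; _+_; _∸_; _<_; _≤ᵇ_)
open import Data.Nat.Properties using (_<?_)
open import Data.Nat.Combinatorics using (_C_)
open import Data.Integer as ℤ using (ℤ; +_; -[1+_])
open import Data.Fin using (Fin; zero; suc; toℕ)
open import Data.Fin.Subset using (Subset; inside; outside; _⊆_; _─_; ∣_∣)
open import Data.Fin.Subset.Properties using (_⊆?_)
open import Data.Vec using (Vec; []; _∷_; tabulate)
open import Data.List using (List; []; _∷_; _++_; map; filter; length)
open import Data.Maybe using (Maybe; just; nothing)
open import Data.Empty using (⊥)
open import Data.Sum using (_⊎_)
open import Data.Product using (_×_)
open import Relation.Nullary using (Dec; yes; no)
open import Relation.Nullary.Decidable using (_⊎-dec_; _×-dec_)
open import Relation.Binary.PropositionalEquality using (_≡_)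
import Data.Nat as ℕ

-- Convention: a subset of [n] = {1,…,n} is a 'Subset n' (a Vec Bool n);
-- the index i : Fin n stands for the element (toℕ i + 1) of [n].

elem : ∀ {n} → Fin n → ℕ
elem i = suc (toℕ i)

minSub : ∀ {n} → Subset n → Maybe (Fin n)
minSub []            = nothing
minSub (inside ∷ p)  = just zero
minSub (outside ∷ p) = Data.Maybe.map suc (minSub p)

MinLess : ∀ {n} → Maybe (Fin n) → Maybe (Fin n) → Set
MinLess (just i) (just j) = toℕ i < toℕ j
MinLess _        _        = ⊥

minLess? : ∀ {n} (x y : Maybe (Fin n)) → Dec (MinLess x y)
minLess? (just i) (just j) = toℕ i <? toℕ j
minLess? (just i) nothing  = no (λ ())
minLess? nothing  (just j) = no (λ ())
minLess? nothing  nothing  = no (λ ())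

_≺_ : ∀ {n} → Subset n → Subset n → Set
A ≺ B = (B ⊆ A) ⊎ MinLess (minSub (A ─ B)) (minSub (B ─ A))

_≺?_ : ∀ {n} (A B : Subset n) → Dec (A ≺ B)
A ≺? B = (B ⊆? A) ⊎-dec minLess? (minSub (A ─ B)) (minSub (B ─ A))

allSubsets : (n : ℕ) → List (Subset n)
allSubsets zero    = [] ∷ []
allSubsets (suc n) = map (outside ∷_) (allSubsets n) ++ map (inside ∷_) (allSubsets n)

cardL : (n : ℕ) → Subset n → ℕ → ℕ
cardL n R k = length (filter (λ F → (∣ F ∣ ℕ.≟ k) ×-dec (F ≺? R)) (allSubsets n))

initSeg : ∀ {n} → Fin n → Subset n
initSeg q = tabulate (λ i → toℕ i ≤ᵇ toℕ q)

-- B is A's partner: A ∩ B = {q}, A ∪ B = [q], q the last element of A and of B.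
-- (That q is the maximum of A and of B follows from the two equations.)
open import Data.Fin.Subset using (_∩_; _∪_; ⁅_⁆)
Partner : ∀ {n} → Subset n → Subset n → Set
Partner {n} A B = Data.Product.Σ (Fin n) (λ q → (A ∩ B ≡ ⁅ q ⁆) × (A ∪ B ≡ initSeg q))

elems : ∀ {n} → Subset n → List ℕ
elems []            = []
elems (inside ∷ p)  = 1 ∷ map suc (elems p)
elems (outside ∷ p) = map suc (elems p)

-- binomial coefficient with integer lower index (0 if the lower index is negative;
-- stdlib's _C_ is already 0 if the lower index exceeds the upper one)
binomℤ : ℕ → ℤ → ℕ
binomℤ x (+ y)    = x C y
binomℤ x -[1+ _ ] = 0

partnerSum′ : ℕ → ℕ → ℕ → List ℕ → ℕ
partnerSum′ n k j []       = 0
partnerSum′ n k j (c ∷ cs) = binomℤ (n ∸ c) (+ (k + j) ℤ.- + c) + partnerSum′ n k (suc j) cs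

partnerSum : ℕ → ℕ → List ℕ → ℕ
partnerSum n k cs = partnerSum′ n k 0 cs

-- Split the k-sets F of [n] by whether they contain 1. If 1 ∈ R, every F ≺ R contains 1, and
-- F ↦ F ∖ {1} matches them with the (k-1)-sets of {2,…,n} preceding R ∖ {1}. If 1 ∉ R, every
-- F ∋ 1 precedes R, contributing binom(n-1, k-1), while the sets avoiding 1 compare with R as
-- subsets of {2,…,n}. For partners A and B, each element below q lies in exactly one of them and
-- q in both; peeling off one position at a time, each b_i ∈ B contributes binom(n-b_i, k-b_i+i-1):
-- the lower index drops by one at every earlier position and rises back by one at every earlier
-- element of B. Partnership is symmetric, which gives the second formula.
module Submission where

open import Defs
open import Data.Nat using (ℕ; zero; suc; _+_; _∸_; _≤_; _≤ᵇ_; z≤n; s≤s)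
open import Data.Nat.Properties using (+-suc; +-comm; +-identityʳ)
open import Data.Nat.Combinatorics using (nCk+nC[k+1]≡[n+1]C[k+1])
open import Data.Integer as ℤ using (ℤ; +_; -[1+_]; _-_)
open import Data.Integer.Properties using (+-injective; suc-pred; pred-suc; minus-suc; pred-+)
import Data.Integer.Properties as ℤₚ
open import Data.Fin as Fin using (Fin; zero; toℕ)
open import Data.Fin.Subset using (Subset; inside; outside; _⊆_; _─_; ∣_∣; _∩_; _∪_; ⁅_⁆) renaming (⊥ to ∅)
open import Data.Fin.Subset.Properties using (drop-∷-⊆; s⊆s; out⊆; ⊥⊆)
open import Data.Vec using ([]; _∷_; tabulate; here)
open import Data.Vec.Properties using (∷-injectiveˡ; ∷-injectiveʳ; tabulate-cong)
open import Data.List using (List; []; _∷_; _++_; map; filter; length)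
open import Data.List.Properties using (filter-++; filter-≐; filter-none; length-++; length-map)
open import Data.List.Relation.Unary.All using (universal)
open import Data.Bool using (false)
open import Data.Maybe using (Maybe; just; nothing)
import Data.Maybe as Maybe
open import Data.Sum using (_⊎_; inj₁; inj₂)
open import Data.Product using (_×_; _,_; proj₂; map₁; map₂)
import Data.Product as Product
open import Function using (_∘_)
open import Level using (0ℓ)
open import Relation.Nullary using (¬_; yes; no)
open import Relation.Nullary.Decidable using (_×-dec_)
open import Relation.Unary using (Pred; Decidable; _≐_)
open import Relation.Binary.PropositionalEquality
open ≡-Reasoning

module _ {A B : Set} where

  filter-map : {P : Pred B 0ℓ} (P? : Decidable P) (f : A → B) (xs : List A) →
    filter P? (map f xs) ≡ map f (filter (P? ∘ f) xs)
  filter-map P? f [] = refl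
  filter-map P? f (x ∷ xs) with P? (f x)
  ... | yes _ = cong (f x ∷_) (filter-map P? f xs)
  ... | no _  = filter-map P? f xs

module _ {A : Set} {P : Pred A 0ℓ} (P? : Decidable P) where

  length-filter-≐ : {Q : Pred A 0ℓ} (Q? : Decidable Q) → P ≐ Q →
    ∀ xs → length (filter P? xs) ≡ length (filter Q? xs)
  length-filter-≐ Q? P≐Q xs = cong length (filter-≐ P? Q? P≐Q xs)

  length-filter-none : (∀ x → ¬ P x) → ∀ xs → length (filter P? xs) ≡ 0
  length-filter-none ¬P xs = cong length (filter-none P? (universal ¬P xs))

length-filter-allSubsets-suc : ∀ {n} {P : Pred (Subset (suc n)) 0ℓ} (P? : Decidable P) →
  length (filter P? (allSubsets (suc n))) ≡
  length (filter (P? ∘ (outside ∷_)) (allSubsets n)) + length (filter (P? ∘ (inside ∷_)) (allSubsets n))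
length-filter-allSubsets-suc {n} P? = begin
  length (filter P? (map (outside ∷_) S ++ map (inside ∷_) S))
    ≡⟨ cong length (filter-++ P? (map (outside ∷_) S) _) ⟩
  length (filter P? (map (outside ∷_) S) ++ filter P? (map (inside ∷_) S))
    ≡⟨ length-++ (filter P? (map (outside ∷_) S)) ⟩
  length (filter P? (map (outside ∷_) S)) + length (filter P? (map (inside ∷_) S))
    ≡⟨ cong₂ _+_ (length-filter-map (outside ∷_)) (length-filter-map (inside ∷_)) ⟩
  length (filter (P? ∘ (outside ∷_)) S) + length (filter (P? ∘ (inside ∷_)) S) ∎
  where
  S = allSubsets n
  length-filter-map : ∀ f → length (filter P? (map f S)) ≡ length (filter (P? ∘ f) S)
  length-filter-map f = trans (cong length (filter-map P? f S)) (length-map f (filter (P? ∘ f) S))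

MinLess-map-suc⁺ : ∀ {n} (x y : Maybe (Fin n)) →
  MinLess x y → MinLess (Maybe.map Fin.suc x) (Maybe.map Fin.suc y)
MinLess-map-suc⁺ (just i) (just j) i<j = s≤s i<j

MinLess-map-suc⁻ : ∀ {n} (x y : Maybe (Fin n)) →
  MinLess (Maybe.map Fin.suc x) (Maybe.map Fin.suc y) → MinLess x y
MinLess-map-suc⁻ (just i) (just j) (s≤s i<j) = i<j

∷-≺-∷⁺ : ∀ {n} s {F R : Subset n} → F ≺ R → (s ∷ F) ≺ (s ∷ R)
∷-≺-∷⁺ s       (inj₁ R⊆F) = inj₁ (s⊆s R⊆F)
∷-≺-∷⁺ inside  {F} {R} (inj₂ m) = inj₂ (MinLess-map-suc⁺ (minSub (F ─ R)) (minSub (R ─ F)) m)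
∷-≺-∷⁺ outside {F} {R} (inj₂ m) = inj₂ (MinLess-map-suc⁺ (minSub (F ─ R)) (minSub (R ─ F)) m)

∷-≺-∷⁻ : ∀ {n} s {F R : Subset n} → (s ∷ F) ≺ (s ∷ R) → F ≺ R
∷-≺-∷⁻ s       (inj₁ R⊆F) = inj₁ (drop-∷-⊆ R⊆F)
∷-≺-∷⁻ inside  {F} {R} (inj₂ m) = inj₂ (MinLess-map-suc⁻ (minSub (F ─ R)) (minSub (R ─ F)) m)
∷-≺-∷⁻ outside {F} {R} (inj₂ m) = inj₂ (MinLess-map-suc⁻ (minSub (F ─ R)) (minSub (R ─ F)) m)

map-suc≡nothing⁻ : ∀ {n} {m : Maybe (Fin n)} → Maybe.map Fin.suc m ≡ nothing → m ≡ nothing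
map-suc≡nothing⁻ {m = nothing} refl = refl

minSub─≡nothing⇒⊆ : ∀ {n} (R F : Subset n) → minSub (R ─ F) ≡ nothing → R ⊆ F
minSub─≡nothing⇒⊆ []            []            _  = λ ()
minSub─≡nothing⇒⊆ (inside  ∷ R) (inside  ∷ F) eq = s⊆s (minSub─≡nothing⇒⊆ R F (map-suc≡nothing⁻ eq))
minSub─≡nothing⇒⊆ (outside ∷ R) (inside  ∷ F) eq = out⊆ (minSub─≡nothing⇒⊆ R F (map-suc≡nothing⁻ eq))
minSub─≡nothing⇒⊆ (outside ∷ R) (outside ∷ F) eq = out⊆ (minSub─≡nothing⇒⊆ R F (map-suc≡nothing⁻ eq))

inside∷≺outside∷ : ∀ {n} (F R : Subset n) → (inside ∷ F) ≺ (outside ∷ R)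
inside∷≺outside∷ F R = by-cases (minSub (R ─ F)) refl
  where
  by-cases : ∀ m → minSub (R ─ F) ≡ m →
    (outside ∷ R ⊆ inside ∷ F) ⊎ MinLess (just zero) (Maybe.map Fin.suc m)
  by-cases (just _) _  = inj₂ (s≤s z≤n)
  by-cases nothing  eq = inj₁ (out⊆ (minSub─≡nothing⇒⊆ R F eq))

outside∷⊀inside∷ : ∀ {n} (F R : Subset n) → ¬ (outside ∷ F) ≺ (inside ∷ R)
outside∷⊀inside∷ F R (inj₁ R⊆F) with R⊆F here
... | ()
outside∷⊀inside∷ F R (inj₂ m) = MinLess-map-suc-zero (minSub (F ─ R)) m
  where
  MinLess-map-suc-zero : ∀ {n} (x : Maybe (Fin n)) → ¬ MinLess (Maybe.map Fin.suc x) (just zero)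
  MinLess-map-suc-zero (just _) ()
  MinLess-map-suc-zero nothing  ()

LexBelow : ∀ {n} → Subset n → ℤ → Pred (Subset n) 0ℓ
LexBelow R k F = (+ ∣ F ∣ ≡ k) × (F ≺ R)

lexBelow? : ∀ {n} (R : Subset n) k → Decidable (LexBelow R k)
lexBelow? R k F = (+ ∣ F ∣ ℤ.≟ k) ×-dec (F ≺? R)

-- cardL with an integer size: the size k - 1 becomes ℤ.pred k with no case split on k,
-- and negative sizes count nothing.
cardLℤ : (n : ℕ) → Subset n → ℤ → ℕ
cardLℤ n R k = length (filter (lexBelow? R k) (allSubsets n))

cardL≡cardLℤ : ∀ n (R : Subset n) k → cardL n R k ≡ cardLℤ n R (+ k)
cardL≡cardLℤ n R k =
  length-filter-≐ _ (lexBelow? R (+ k)) (map₁ (cong (+_)) , map₁ +-injective) (allSubsets n)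

+∣inside∷∣≡⇒+∣∣≡pred : ∀ {n} (F : Subset n) {k} → + ∣ inside ∷ F ∣ ≡ k → + ∣ F ∣ ≡ ℤ.pred k
+∣inside∷∣≡⇒+∣∣≡pred F refl = sym (pred-suc (+ ∣ F ∣))

+∣∣≡pred⇒+∣inside∷∣≡ : ∀ {n} (F : Subset n) {k} → + ∣ F ∣ ≡ ℤ.pred k → + ∣ inside ∷ F ∣ ≡ k
+∣∣≡pred⇒+∣inside∷∣≡ F {k} eq = trans (cong ℤ.suc eq) (suc-pred k)

cardLℤ-inside∷ : ∀ n (R : Subset n) k → cardLℤ (suc n) (inside ∷ R) k ≡ cardLℤ n R (ℤ.pred k)
cardLℤ-inside∷ n R k = begin
  cardLℤ (suc n) (inside ∷ R) k
    ≡⟨ length-filter-allSubsets-suc R? ⟩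
  length (filter (R? ∘ (outside ∷_)) (allSubsets n)) + length (filter (R? ∘ (inside ∷_)) (allSubsets n))
    ≡⟨ cong₂ _+_ (length-filter-none (R? ∘ (outside ∷_)) (λ F → outside∷⊀inside∷ F R ∘ proj₂) (allSubsets n))
                 (length-filter-≐ (R? ∘ (inside ∷_)) (lexBelow? R (ℤ.pred k)) inside-part (allSubsets n)) ⟩
  cardLℤ n R (ℤ.pred k) ∎
  where
  R? = lexBelow? (inside ∷ R) k
  inside-part : LexBelow (inside ∷ R) k ∘ (inside ∷_) ≐ LexBelow R (ℤ.pred k)
  inside-part = (λ {F} → Product.map (+∣inside∷∣≡⇒+∣∣≡pred F) (∷-≺-∷⁻ inside))
              , (λ {F} → Product.map (+∣∣≡pred⇒+∣inside∷∣≡ F) (∷-≺-∷⁺ inside))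

cardLℤ-outside∷ : ∀ n (R : Subset n) k →
  cardLℤ (suc n) (outside ∷ R) k ≡ cardLℤ n ∅ (ℤ.pred k) + cardLℤ n R k
cardLℤ-outside∷ n R k = begin
  cardLℤ (suc n) (outside ∷ R) k
    ≡⟨ length-filter-allSubsets-suc R? ⟩
  length (filter (R? ∘ (outside ∷_)) (allSubsets n)) + length (filter (R? ∘ (inside ∷_)) (allSubsets n))
    ≡⟨ cong₂ _+_ (length-filter-≐ (R? ∘ (outside ∷_)) (lexBelow? R k) outside-part (allSubsets n))
                 (length-filter-≐ (R? ∘ (inside ∷_)) (lexBelow? ∅ (ℤ.pred k)) inside-part (allSubsets n)) ⟩
  cardLℤ n R k + cardLℤ n ∅ (ℤ.pred k)
    ≡⟨ +-comm (cardLℤ n R k) _ ⟩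
  cardLℤ n ∅ (ℤ.pred k) + cardLℤ n R k ∎
  where
  R? = lexBelow? (outside ∷ R) k
  outside-part : LexBelow (outside ∷ R) k ∘ (outside ∷_) ≐ LexBelow R k
  outside-part = map₂ (∷-≺-∷⁻ outside) , map₂ (∷-≺-∷⁺ outside)
  inside-part : LexBelow (outside ∷ R) k ∘ (inside ∷_) ≐ LexBelow ∅ (ℤ.pred k)
  inside-part = (λ {F} → Product.map (+∣inside∷∣≡⇒+∣∣≡pred F) (λ _ → inj₁ ⊥⊆))
              , (λ {F} → Product.map (+∣∣≡pred⇒+∣inside∷∣≡ F) (λ _ → inside∷≺outside∷ F R))

binomℤ-pascal : ∀ n k → binomℤ n (ℤ.pred k) + binomℤ n k ≡ binomℤ (suc n) k
binomℤ-pascal n (+ zero)  = refl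
binomℤ-pascal n (+ suc k) = nCk+nC[k+1]≡[n+1]C[k+1] n k
binomℤ-pascal n -[1+ k ]  = refl

cardLℤ-∅ : ∀ n k → cardLℤ n ∅ k ≡ binomℤ n k
cardLℤ-∅ zero    (+ zero)  = refl
cardLℤ-∅ zero    (+ suc k) = refl
cardLℤ-∅ zero    -[1+ k ]  = refl
cardLℤ-∅ (suc n) k         = begin
  cardLℤ (suc n) ∅ k                          ≡⟨ cardLℤ-outside∷ n ∅ k ⟩
  cardLℤ n ∅ (ℤ.pred k) + cardLℤ n ∅ k        ≡⟨ cong₂ _+_ (cardLℤ-∅ n (ℤ.pred k)) (cardLℤ-∅ n k) ⟩
  binomℤ n (ℤ.pred k) + binomℤ n k            ≡⟨ binomℤ-pascal n k ⟩
  binomℤ (suc n) k                            ∎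

partnerSumℤ : ℕ → ℤ → List ℕ → ℕ
partnerSumℤ n k []       = 0
partnerSumℤ n k (c ∷ cs) = binomℤ (n ∸ c) (k - + c) + partnerSumℤ n (ℤ.suc k) cs

partnerSum′≡partnerSumℤ : ∀ n k j cs → partnerSum′ n k j cs ≡ partnerSumℤ n (+ (k + j)) cs
partnerSum′≡partnerSumℤ n k j []       = refl
partnerSum′≡partnerSumℤ n k j (c ∷ cs) = cong₂ _+_ refl (begin
  partnerSum′ n k (suc j) cs       ≡⟨ partnerSum′≡partnerSumℤ n k (suc j) cs ⟩
  partnerSumℤ n (+ (k + suc j)) cs ≡⟨ cong (λ m → partnerSumℤ n (+ m) cs) (+-suc k j) ⟩
  partnerSumℤ n (+ suc (k + j)) cs ∎)

partnerSum≡partnerSumℤ : ∀ n k cs → partnerSum n k cs ≡ partnerSumℤ n (+ k) cs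
partnerSum≡partnerSumℤ n k cs = begin
  partnerSum′ n k 0 cs             ≡⟨ partnerSum′≡partnerSumℤ n k 0 cs ⟩
  partnerSumℤ n (+ (k + 0)) cs     ≡⟨ cong (λ m → partnerSumℤ n (+ m) cs) (+-identityʳ k) ⟩
  partnerSumℤ n (+ k) cs           ∎

partnerSumℤ-map-suc : ∀ n k cs → partnerSumℤ (suc n) k (map suc cs) ≡ partnerSumℤ n (ℤ.pred k) cs
partnerSumℤ-map-suc n k []       = refl
partnerSumℤ-map-suc n k (c ∷ cs) = cong₂ _+_
  (cong (binomℤ (n ∸ c)) (trans (minus-suc k c) (sym (pred-+ k (ℤ.- + c)))))
  (begin
    partnerSumℤ (suc n) (ℤ.suc k) (map suc cs) ≡⟨ partnerSumℤ-map-suc n (ℤ.suc k) cs ⟩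
    partnerSumℤ n (ℤ.pred (ℤ.suc k)) cs        ≡⟨ cong (λ i → partnerSumℤ n i cs) (pred-suc k) ⟩
    partnerSumℤ n k cs                         ≡⟨ cong (λ i → partnerSumℤ n i cs) (suc-pred k) ⟨
    partnerSumℤ n (ℤ.suc (ℤ.pred k)) cs        ∎)

partnerSumℤ-1∷map-suc : ∀ n k cs →
  partnerSumℤ (suc n) k (1 ∷ map suc cs) ≡ binomℤ n (ℤ.pred k) + partnerSumℤ n k cs
partnerSumℤ-1∷map-suc n k cs = begin
  partnerSumℤ (suc n) k (map suc (0 ∷ cs))
    ≡⟨ partnerSumℤ-map-suc n k (0 ∷ cs) ⟩
  binomℤ n (ℤ.pred k - + 0) + partnerSumℤ n (ℤ.suc (ℤ.pred k)) cs
    ≡⟨ cong₂ (λ i j → binomℤ n i + partnerSumℤ n j cs) (ℤₚ.+-identityʳ (ℤ.pred k)) (suc-pred k) ⟩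
  binomℤ n (ℤ.pred k) + partnerSumℤ n k cs ∎

data Partners : ∀ {n} → Subset n → Subset n → Set where
  last           : ∀ {n} → Partners {suc n} (inside ∷ ∅) (inside ∷ ∅)
  inside-outside : ∀ {n} {A B : Subset n} → Partners A B → Partners (inside ∷ A) (outside ∷ B)
  outside-inside : ∀ {n} {A B : Subset n} → Partners A B → Partners (outside ∷ A) (inside ∷ B)

Partners-sym : ∀ {n} {A B : Subset n} → Partners A B → Partners B A
Partners-sym last               = last
Partners-sym (inside-outside p) = outside-inside (Partners-sym p)
Partners-sym (outside-inside p) = inside-outside (Partners-sym p)

initSeg-zero : ∀ {n} → initSeg {suc n} zero ≡ inside ∷ ∅
initSeg-zero {n} = cong (inside ∷_) (tabulate-false n)
  where
  tabulate-false : ∀ n → tabulate {n = n} (λ _ → false) ≡ ∅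
  tabulate-false zero    = refl
  tabulate-false (suc n) = cong (outside ∷_) (tabulate-false n)

initSeg-suc : ∀ {n} (q : Fin n) → initSeg (Fin.suc q) ≡ inside ∷ initSeg q
initSeg-suc q = cong (inside ∷_) (tabulate-cong (λ i → suc≤ᵇsuc (toℕ i) (toℕ q)))
  where
  suc≤ᵇsuc : ∀ m n → (suc m ≤ᵇ suc n) ≡ (m ≤ᵇ n)
  suc≤ᵇsuc zero    n = refl
  suc≤ᵇsuc (suc m) n = refl

∪≡⊥⇒≡⊥ : ∀ {n} (A B : Subset n) → A ∪ B ≡ ∅ → (A ≡ ∅) × (B ≡ ∅)
∪≡⊥⇒≡⊥ []            []            _  = refl , refl
∪≡⊥⇒≡⊥ (outside ∷ A) (outside ∷ B) eq with ∪≡⊥⇒≡⊥ A B (∷-injectiveʳ eq)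
... | refl , refl = refl , refl
∪≡⊥⇒≡⊥ (inside  ∷ A) (_       ∷ B) eq with () ← ∷-injectiveˡ eq
∪≡⊥⇒≡⊥ (outside ∷ A) (inside  ∷ B) eq with () ← ∷-injectiveˡ eq

Partner⇒Partners : ∀ {n} (A B : Subset n) (q : Fin n) → A ∩ B ≡ ⁅ q ⁆ → A ∪ B ≡ initSeg q → Partners A B
Partner⇒Partners (inside ∷ A) (inside ∷ B) zero _ A∪B≡[q]
  with refl , refl ← ∪≡⊥⇒≡⊥ A B (∷-injectiveʳ (trans A∪B≡[q] initSeg-zero)) = last
Partner⇒Partners (inside  ∷ A) (inside  ∷ B) (Fin.suc q) A∩B≡q _ with () ← ∷-injectiveˡ A∩B≡q
Partner⇒Partners (inside  ∷ A) (outside ∷ B) zero        A∩B≡q _ with () ← ∷-injectiveˡ A∩B≡q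
Partner⇒Partners (outside ∷ A) (_       ∷ B) zero        A∩B≡q _ with () ← ∷-injectiveˡ A∩B≡q
Partner⇒Partners (outside ∷ A) (outside ∷ B) (Fin.suc q) _ A∪B≡[q]
  with () ← ∷-injectiveˡ (trans A∪B≡[q] (initSeg-suc q))
Partner⇒Partners (inside ∷ A) (outside ∷ B) (Fin.suc q) A∩B≡q A∪B≡[q] = inside-outside
  (Partner⇒Partners A B q (∷-injectiveʳ A∩B≡q) (∷-injectiveʳ (trans A∪B≡[q] (initSeg-suc q))))
Partner⇒Partners (outside ∷ A) (inside ∷ B) (Fin.suc q) A∩B≡q A∪B≡[q] = outside-inside
  (Partner⇒Partners A B q (∷-injectiveʳ A∩B≡q) (∷-injectiveʳ (trans A∪B≡[q] (initSeg-suc q))))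

elems-∅ : ∀ n → elems (∅ {n = n}) ≡ []
elems-∅ zero    = refl
elems-∅ (suc n) = cong (map suc) (elems-∅ n)

cardLℤ-Partners : ∀ {n} {A B : Subset n} → Partners A B → ∀ k → cardLℤ n A k ≡ partnerSumℤ n k (elems B)
cardLℤ-Partners {suc n} last k = begin
  cardLℤ (suc n) (inside ∷ ∅) k                    ≡⟨ cardLℤ-inside∷ n ∅ k ⟩
  cardLℤ n ∅ (ℤ.pred k)                            ≡⟨ cardLℤ-∅ n (ℤ.pred k) ⟩
  binomℤ n (ℤ.pred k)                              ≡⟨ +-identityʳ _ ⟨
  binomℤ n (ℤ.pred k) + partnerSumℤ n k []         ≡⟨ cong (λ cs → binomℤ n (ℤ.pred k) + partnerSumℤ n k cs) (elems-∅ n) ⟨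
  binomℤ n (ℤ.pred k) + partnerSumℤ n k (elems ∅ₙ) ≡⟨ partnerSumℤ-1∷map-suc n k (elems ∅ₙ) ⟨
  partnerSumℤ (suc n) k (elems (inside ∷ ∅ₙ))      ∎
  where ∅ₙ = ∅ {n = n}
cardLℤ-Partners {suc n} {inside ∷ A} {outside ∷ B} (inside-outside p) k = begin
  cardLℤ (suc n) (inside ∷ A) k                  ≡⟨ cardLℤ-inside∷ n A k ⟩
  cardLℤ n A (ℤ.pred k)                          ≡⟨ cardLℤ-Partners p (ℤ.pred k) ⟩
  partnerSumℤ n (ℤ.pred k) (elems B)             ≡⟨ partnerSumℤ-map-suc n k (elems B) ⟨
  partnerSumℤ (suc n) k (elems (outside ∷ B))    ∎
cardLℤ-Partners {suc n} {outside ∷ A} {inside ∷ B} (outside-inside p) k = begin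
  cardLℤ (suc n) (outside ∷ A) k                      ≡⟨ cardLℤ-outside∷ n A k ⟩
  cardLℤ n ∅ (ℤ.pred k) + cardLℤ n A k                ≡⟨ cong₂ _+_ (cardLℤ-∅ n (ℤ.pred k)) (cardLℤ-Partners p k) ⟩
  binomℤ n (ℤ.pred k) + partnerSumℤ n k (elems B)     ≡⟨ partnerSumℤ-1∷map-suc n k (elems B) ⟨
  partnerSumℤ (suc n) k (elems (inside ∷ B))          ∎

cardL-Partners : ∀ {n} {A B : Subset n} → Partners A B → ∀ k → cardL n A k ≡ partnerSum n k (elems B)
cardL-Partners {n} {A} {B} p k = begin
  cardL n A k                   ≡⟨ cardL≡cardLℤ n A k ⟩
  cardLℤ n A (+ k)              ≡⟨ cardLℤ-Partners p (+ k) ⟩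
  partnerSumℤ n (+ k) (elems B) ≡⟨ partnerSum≡partnerSumℤ n k (elems B) ⟨
  partnerSum n k (elems B)      ∎

proposition4 : (k l n : ℕ) → 1 ≤ k → 1 ≤ l → 1 ≤ n →
    (A B : Subset n) → Partner A B →
    (cardL n A k ≡ partnerSum n k (elems B)) × (cardL n B l ≡ partnerSum n l (elems A))
proposition4 k l n _ _ _ A B (q , A∩B≡q , A∪B≡[q]) =
  cardL-Partners partners k , cardL-Partners (Partners-sym partners) l
  where
  partners : Partners A B
  partners = Partner⇒Partners A B q A∩B≡q A∪B≡[q]
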